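{- Let $k$ be a positive integer. Suppose $G$ is a (simple, undirected) graph on $n$ vertices with girth at least $2k+1$ that contains $h$ Hamilton cycles. Then $M_k(S_n)\ge h/2^{n-1}$.
   Context: For a group $\Gamma$, $A\subseteq\Gamma$ is an $S_k$-set if whenever $\alpha_1\cdots\alpha_k=\beta_1\cdots\beta_k$ with all $\alpha_i,\beta_i\in A$, we have $(\alpha_1,\ldots,\alpha_k)=(\beta_1,\ldots,\beta_k)$. $M_k(\Gamma)$ denotes the maximum size of an $S_k$-set in $\Gamma$. $S_n$ is the symmetric group on $n$ letters. -}

module Defs where

open import Data.Nat using (ℕ; zero; suc; _≤_; _<_; _*_; _^_; _∸_)
open import Data.Nat.DivMod using (_mod_)
open import Data.Fin using (Fin; toℕ) renaming (zero to fzero; suc to fsuc)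
open import Data.Fin.Permutation using (Permutation′; _∘ₚ_; id; _≈_)
open import Data.List using (List; length; lookup)
open import Data.List.Relation.Unary.AllPairs using (AllPairs)
open import Data.Product using (Σ; ∃; _×_; _,_)
open import Data.Sum using (_⊎_)
open import Data.Empty using (⊥)
open import Function.Definitions using (Injective)
open import Relation.Nullary using (¬_)
open import Relation.Binary.PropositionalEquality using (_≡_)

record Graph (n : ℕ) : Set₁ where
  field
    Adj    : Fin n → Fin n → Set
    sym    : ∀ {u v} → Adj u v → Adj v u
    irrefl : ∀ {u} → ¬ Adj u u

open Graph public

next : ∀ {m} → Fin m → Fin m
next {suc m} i = suc (toℕ i) mod suc m

IsCycle : ∀ {n} → Graph n → (m : ℕ) → (Fin m → Fin n) → Set
IsCycle G m c = Injective _≡_ _≡_ c × (∀ i → Adj G (c i) (c (next i)))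

Cycle : ∀ {n} → Graph n → ℕ → Set
Cycle {n} G m = Σ (Fin m → Fin n) (IsCycle G m)

GirthAtLeast : ∀ {n} → Graph n → ℕ → Set
GirthAtLeast G g = ∀ m → 3 ≤ m → m < g → ¬ Cycle G m

HamCycle : ∀ {n} → Graph n → Set
HamCycle {n} G = (3 ≤ n) × Cycle G n

CycEdge : ∀ {n m} → (Fin m → Fin n) → Fin n → Fin n → Set
CycEdge c u w = ∃ λ i → (c i ≡ u × c (next i) ≡ w) ⊎ (c i ≡ w × c (next i) ≡ u)

-- two Hamilton cycles are the same subgraph iff they have the same edge set
SameCycle : ∀ {n} (G : Graph n) → HamCycle G → HamCycle G → Set
SameCycle G (_ , c , _) (_ , d , _) =
  ∀ u w → (CycEdge c u w → CycEdge d u w) × (CycEdge d u w → CycEdge c u w)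

prod : ∀ {n k} → (Fin k → Permutation′ n) → Permutation′ n
prod {k = zero}  α = id
prod {k = suc k} α = α fzero ∘ₚ prod (λ i → α (fsuc i))

-- Tuples of elements of A are given by tuples of positions in the list.
IsSkSet : ∀ {n} → ℕ → List (Permutation′ n) → Set
IsSkSet k A =
  AllPairs (λ π ρ → ¬ (π ≈ ρ)) A ×
  (∀ (α β : Fin k → Fin (length A)) →
     prod (λ i → lookup A (α i)) ≈ prod (λ i → lookup A (β i)) →
     ∀ i → α i ≡ β i)

{-# OPTIONS --safe #-}

-- Traversing a Hamilton cycle in either direction gives a permutation moving every vertex to a
-- neighbour, with no 2-cycles; distinct cycles give 2h distinct permutations. Orient each edge of
-- the complete graph by a fair coin: a fixed traversal follows all of its n edges with
-- probability 2^-n, so some orientation is followed by at least 2h / 2^n traversals. Two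
-- traversals following the same orientation never use an edge in opposite directions, so from
-- any start vertex a product α₁ ⋯ α_k of them traces a non-backtracking walk of length k. If two
-- such products agree but their walks differ, joining the walks at the last step where they
-- differ gives a closed non-backtracking walk of length at most 2k, which contains a cycle of
-- length between 3 and 2k, contradicting the girth. So equal products have equal factors.

module Submission where

open import Defs
open import Data.Nat using (ℕ; suc; _≤_; _*_; _^_; _∸_; _+_)
open import Data.Vec using (Vec; lookup)
open import Data.Fin using (Fin)
open import Relation.Binary.PropositionalEquality using (_≢_)
open import Data.List using (List; length)
open import Data.Fin.Permutation using (Permutation′)
open import Data.Product using (Σ; _×_)
open import Relation.Nullary using (¬_)

open import Data.Bool as Bool using (Bool; true; false)
open import Data.Empty using (⊥-elim)
open import Data.Fin as Fin using (toℕ; punchOut) renaming (zero to fzero; suc to fsuc)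
open import Data.Fin.Permutation using (_⟨$⟩ʳ_; _⟨$⟩ˡ_; inverseˡ; inverseʳ; flip; _∘ₚ_; _≈_; permutation)
open import Data.Fin.Properties as Fin using (toℕ-fromℕ<; toℕ-injective; toℕ<n; punchOut-injective; injective⇒≤)
import Data.List as List
import Data.List.Properties as List
open import Data.List.Base using ([]; _∷_)
open import Data.List.Membership.Propositional using (_∈_; find)
open import Data.List.Membership.Propositional.Properties using (∈-lookup; ∈-map⁺; ∈-map⁻; ∈-allFin)
open import Data.List.Relation.Unary.All as All using (All; []; _∷_)
import Data.List.Relation.Unary.All.Properties as All
open import Data.List.Relation.Unary.AllPairs using (AllPairs; _∷_)
import Data.List.Relation.Unary.AllPairs.Properties as AllPairs
open import Data.List.Relation.Unary.Any as Any using (here; there)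
open import Data.Nat as ℕ using (zero; _<_; z≤n; s≤s)
open import Data.Nat.DivMod using (m<n⇒m%n≡m; n%n≡0; %-congˡ)
open import Data.Nat.Induction using (<-wellFounded)
import Data.Nat.Properties as ℕ
open import Algebra.Properties.CommutativeSemigroup ℕ.+-commutativeSemigroup using ()
  renaming (interchange to +-interchange)
open import Algebra.Properties.CommutativeSemigroup ℕ.*-commutativeSemigroup using ()
  renaming (x∙yz≈y∙xz to *-comm-middle)
open import Data.Product using (∃; _,_; proj₁; proj₂; swap)
open import Data.Sum using (_⊎_; inj₁; inj₂; [_,_]′; reduce)
open import Data.Vec using ([]; _∷_)
open import Function using (id; _∘_; _⇔_; mk⇔; module Equivalence)
open import Function.Construct.Composition using (_⇔-∘_)
open import Function.Definitions using (Injective; StrictlySurjective)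
open import Induction.WellFounded using (Acc; acc)
open import Relation.Binary.Core using (Rel)
open import Relation.Binary.Definitions using (Symmetric; tri<; tri≈; tri>)
open import Relation.Binary.PropositionalEquality as ≡ using (_≡_; refl; trans; cong; cong₂; subst; subst₂)
open import Relation.Nullary using (Dec; yes; no; contradiction)
open import Relation.Nullary.Decidable using (_×-dec_)
open import Relation.Unary using (Decidable)

toℕ-next : ∀ {m} (i : Fin m) →
           toℕ (next i) ≡ suc (toℕ i) ⊎ (toℕ (next i) ≡ 0 × suc (toℕ i) ≡ m)
toℕ-next {suc m} i with suc (toℕ i) ℕ.<? suc m
... | yes i+1<m = inj₁ (trans (toℕ-fromℕ< _) (m<n⇒m%n≡m i+1<m))
... | no  i+1≮m = inj₂ (trans (toℕ-fromℕ< _) (trans (%-congˡ {o = suc m} i+1≡m) (n%n≡0 (suc m))) , i+1≡m)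
  where i+1≡m = ℕ.≤-antisym (toℕ<n i) (ℕ.≮⇒≥ i+1≮m)

next-injective : ∀ {m} → Injective _≡_ _≡_ (next {m})
next-injective {x = i} {j} eq with toℕ-next i | toℕ-next j | cong toℕ eq
... | inj₁ p       | inj₁ q       | e = toℕ-injective (ℕ.suc-injective (trans (≡.sym p) (trans e q)))
... | inj₁ p       | inj₂ (q , _) | e = contradiction (trans (≡.sym p) (trans e q)) ℕ.1+n≢0
... | inj₂ (p , _) | inj₁ q       | e = contradiction (trans (≡.sym q) (trans (≡.sym e) p)) ℕ.1+n≢0
... | inj₂ (_ , p) | inj₂ (_ , q) | _ = toℕ-injective (ℕ.suc-injective (trans p (≡.sym q)))

next²≡id⇒≤2 : ∀ {m} (i : Fin m) → next (next i) ≡ i → m ≤ 2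
next²≡id⇒≤2 i eq with toℕ-next i | toℕ-next (next i) | cong toℕ eq
... | inj₁ p       | inj₁ q       | e = contradiction (trans (≡.sym e) (trans q (cong suc p))) (ℕ.m≢1+n+m (toℕ i))
... | inj₁ p       | inj₂ (q , r) | e =
  ℕ.≤-reflexive (trans (≡.sym r) (cong suc (trans p (cong suc (trans (≡.sym e) q)))))
... | inj₂ (p , r) | inj₁ q       | e =
  ℕ.≤-reflexive (trans (≡.sym r) (cong suc (trans (≡.sym e) (trans q (cong suc p)))))
... | inj₂ (p , _) | inj₂ (_ , s) | _ = ℕ.m≤n⇒m≤1+n (ℕ.≤-reflexive (trans (≡.sym s) (cong suc p)))

next²≢id : ∀ {m} → 3 ≤ m → (i : Fin m) → next (next i) ≢ i
next²≢id 3≤m i = ℕ.<⇒≱ 3≤m ∘ next²≡id⇒≤2 i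

injective⇒strictlySurjective : ∀ {n} {f : Fin n → Fin n} → Injective _≡_ _≡_ f → StrictlySurjective _≡_ f
injective⇒strictlySurjective {suc n} {f} f-injective y with Fin.any? (λ x → f x Fin.≟ y)
... | yes hit = hit
... | no miss = contradiction (injective⇒≤ g-injective) ℕ.1+n≰n
  where
    y≢f : ∀ x → y ≢ f x
    y≢f x y≡fx = miss (x , ≡.sym y≡fx)
    g : Fin (suc n) → Fin n
    g x = punchOut (y≢f x)
    g-injective : Injective _≡_ _≡_ g
    g-injective = f-injective ∘ punchOut-injective (y≢f _) (y≢f _)

injective⇒permutation : ∀ {n} {f : Fin n → Fin n} → Injective _≡_ _≡_ f → Permutation′ n
injective⇒permutation {f = f} f-injective =
  permutation f (proj₁ ∘ surjective) (proj₂ ∘ surjective) (λ x → f-injective (proj₂ (surjective (f x))))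
  where surjective = injective⇒strictlySurjective f-injective

PermEdge : ∀ {n} → Permutation′ n → Fin n → Fin n → Set
PermEdge π u w = π ⟨$⟩ʳ u ≡ w ⊎ π ⟨$⟩ʳ w ≡ u

PermEdge-flip : ∀ {n} (π : Permutation′ n) {u w} → PermEdge π u w → PermEdge (flip π) u w
PermEdge-flip π (inj₁ πu≡w) = inj₂ (trans (cong (π ⟨$⟩ˡ_) (≡.sym πu≡w)) (inverseˡ π))
PermEdge-flip π (inj₂ πw≡u) = inj₁ (trans (cong (π ⟨$⟩ˡ_) (≡.sym πw≡u)) (inverseˡ π))

PermEdge-≈ : ∀ {n} {π ρ : Permutation′ n} {u w} → π ≈ ρ → PermEdge π u w → PermEdge ρ u w
PermEdge-≈ π≈ρ (inj₁ πu≡w) = inj₁ (trans (≡.sym (π≈ρ _)) πu≡w)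
PermEdge-≈ π≈ρ (inj₂ πw≡u) = inj₂ (trans (≡.sym (π≈ρ _)) πw≡u)

AlongEdges : ∀ {n} → Graph n → Permutation′ n → Set
AlongEdges G π = ∀ u → Adj G u (π ⟨$⟩ʳ u)

NonReversing : ∀ {n} → Permutation′ n → Permutation′ n → Set
NonReversing π ρ = ∀ u → ρ ⟨$⟩ʳ (π ⟨$⟩ʳ u) ≢ u

AlongEdges-flip : ∀ {n} (G : Graph n) {π} → AlongEdges G π → AlongEdges G (flip π)
AlongEdges-flip G {π} along u = sym G (subst (Adj G (flip π ⟨$⟩ʳ u)) (inverseʳ π) (along (flip π ⟨$⟩ʳ u)))

NonReversing-flip : ∀ {n} {π : Permutation′ n} → NonReversing π π → NonReversing (flip π) (flip π)
NonReversing-flip {π = π} nonReversing u π⁻²u≡u = nonReversing u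
  (trans (cong (λ v → π ⟨$⟩ʳ (π ⟨$⟩ʳ v)) (≡.sym π⁻²u≡u)) (trans (cong (π ⟨$⟩ʳ_) (inverseʳ π)) (inverseʳ π)))

module _ {n : ℕ} (G : Graph n) where

  rotation : HamCycle G → Permutation′ n
  rotation (_ , _ , c-injective , _) = flip C ∘ₚ (injective⇒permutation next-injective ∘ₚ C)
    where C = injective⇒permutation c-injective

  module _ (hc : HamCycle G) where
    private
      c : Fin n → Fin n
      c = proj₁ (proj₂ hc)
      c-injective : Injective _≡_ _≡_ c
      c-injective = proj₁ (proj₂ (proj₂ hc))
      c-adjacent : ∀ i → Adj G (c i) (c (next i))
      c-adjacent = proj₂ (proj₂ (proj₂ hc))
      C σ : Permutation′ n
      C = injective⇒permutation c-injective
      σ = rotation hc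

    rotation-cycle : ∀ i → σ ⟨$⟩ʳ c i ≡ c (next i)
    rotation-cycle i = cong (c ∘ next) (inverseˡ C)

    rotation-adjacent : ∀ u → Adj G u (σ ⟨$⟩ʳ u)
    rotation-adjacent u = subst (λ v → Adj G v (σ ⟨$⟩ʳ u)) (inverseʳ C) (c-adjacent (C ⟨$⟩ˡ u))

    rotation²≢id : ∀ u → σ ⟨$⟩ʳ (σ ⟨$⟩ʳ u) ≢ u
    rotation²≢id u σ²u≡u = next²≢id (proj₁ hc) (C ⟨$⟩ˡ u)
      (c-injective (trans (≡.sym (rotation-cycle (next (C ⟨$⟩ˡ u)))) (trans σ²u≡u (≡.sym (inverseʳ C)))))

    rotation≉flip : ¬ σ ≈ flip σ
    rotation≉flip σ≈σ⁻¹ = rotation²≢id u (trans (σ≈σ⁻¹ (σ ⟨$⟩ʳ u)) (inverseˡ σ))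
      where u = Fin.fromℕ< (ℕ.<-≤-trans (s≤s z≤n) (proj₁ hc))

    CycEdge⇔PermEdge : ∀ {u w} → CycEdge c u w ⇔ PermEdge σ u w
    CycEdge⇔PermEdge = mk⇔ to from
      where
        to : ∀ {u w} → CycEdge c u w → PermEdge σ u w
        to (i , inj₁ (ci≡u , cnexti≡w)) =
          inj₁ (trans (cong (σ ⟨$⟩ʳ_) (≡.sym ci≡u)) (trans (rotation-cycle i) cnexti≡w))
        to (i , inj₂ (ci≡w , cnexti≡u)) =
          inj₂ (trans (cong (σ ⟨$⟩ʳ_) (≡.sym ci≡w)) (trans (rotation-cycle i) cnexti≡u))
        from : ∀ {u w} → PermEdge σ u w → CycEdge c u w
        from {u} (inj₁ σu≡w) = C ⟨$⟩ˡ u , inj₁ (inverseʳ C , σu≡w)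
        from {w = w} (inj₂ σw≡u) = C ⟨$⟩ˡ w , inj₂ (inverseʳ C , σw≡u)

-- Non-backtracking walks

-- A walk of length L is x 0, …, x L; the values of x beyond L are irrelevant.
IsWalk : ∀ {n} → Graph n → ℕ → (ℕ → Fin n) → Set
IsWalk G L x = ∀ a → a < L → Adj G (x a) (x (suc a))

NonBacktracking : ∀ {n} → ℕ → (ℕ → Fin n) → Set
NonBacktracking L x = ∀ a → suc (suc a) ≤ L → x a ≢ x (suc (suc a))

segment : ∀ {n} → ℕ → (ℕ → Fin n) → ℕ → Fin n
segment a x b = x (a + b)

reverse : ∀ {n} → ℕ → (ℕ → Fin n) → ℕ → Fin n
reverse L x b = x (L ∸ b)

append : ∀ {n} → ℕ → (ℕ → Fin n) → (ℕ → Fin n) → ℕ → Fin n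
append zero    x y a       = y a
append (suc m) x y zero    = x zero
append (suc m) x y (suc a) = append m (x ∘ suc) y a

append-head : ∀ {n} m {x y : ℕ → Fin n} → x m ≡ y 0 → append m x y 0 ≡ x 0
append-head zero    join = ≡.sym join
append-head (suc m) join = refl

append-+ : ∀ {n} m {x y : ℕ → Fin n} b → append m x y (m + b) ≡ y b
append-+ zero    b = refl
append-+ (suc m) b = append-+ m b

NonBacktracking-segment : ∀ {n L a l} {x : ℕ → Fin n} → NonBacktracking L x → a + l ≤ L →
                          NonBacktracking l (segment a x)
NonBacktracking-segment {a = a} {x = x} nb a+l≤L b b+2≤l xa+b≡xa+b+2 =
  nb (a + b) (ℕ.≤-trans (ℕ.≤-reflexive (≡.sym a+b+2≡)) (ℕ.≤-trans (ℕ.+-monoʳ-≤ a b+2≤l) a+l≤L))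
     (trans xa+b≡xa+b+2 (cong x a+b+2≡))
  where a+b+2≡ = trans (ℕ.+-suc a (suc b)) (cong suc (ℕ.+-suc a b))

NonBacktracking-reverse : ∀ {n L} {x : ℕ → Fin n} → NonBacktracking L x → NonBacktracking L (reverse L x)
NonBacktracking-reverse {L = L} {x} nb b b+2≤L xL-b≡xL-b-2 =
  nb (L ∸ suc (suc b)) (ℕ.≤-trans (ℕ.≤-reflexive (≡.sym L-b≡)) (ℕ.m∸n≤m L b))
     (≡.sym (trans (cong x (≡.sym L-b≡)) xL-b≡xL-b-2))
  where
    L-b≡ : L ∸ b ≡ suc (suc (L ∸ suc (suc b)))
    L-b≡ = trans (ℕ.+-∸-assoc 1 (ℕ.<⇒≤ b+2≤L)) (cong suc (ℕ.+-∸-assoc 1 b+2≤L))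

NonBacktracking-append : ∀ {n} t {l} {x y : ℕ → Fin n} → x (suc t) ≡ y 0 →
                         NonBacktracking (suc t) x → NonBacktracking l y → x t ≢ y 1 →
                         NonBacktracking (suc t + l) (append (suc t) x y)
NonBacktracking-append zero    join nbx nby turn zero    _    = turn
NonBacktracking-append zero    join nbx nby turn (suc a) a+3≤ = nby a (ℕ.≤-pred a+3≤)
NonBacktracking-append (suc t) join nbx nby turn zero    _    x0≡x2 =
  nbx 0 (s≤s (s≤s z≤n)) (trans x0≡x2 (append-head t join))
NonBacktracking-append (suc t) join nbx nby turn (suc a) a+3≤ =
  NonBacktracking-append t join (λ b b+2≤ → nbx (suc b) (s≤s b+2≤)) nby turn a (ℕ.≤-pred a+3≤)

module _ {n : ℕ} (G : Graph n) where

  IsWalk-segment : ∀ {L a l} {x : ℕ → Fin n} → IsWalk G L x → a + l ≤ L → IsWalk G l (segment a x)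
  IsWalk-segment {a = a} {x = x} walk a+l≤L b b<l =
    subst (Adj G (x (a + b))) (cong x (≡.sym (ℕ.+-suc a b)))
      (walk (a + b) (ℕ.<-≤-trans (ℕ.+-monoʳ-< a b<l) a+l≤L))

  IsWalk-reverse : ∀ {L} {x : ℕ → Fin n} → IsWalk G L x → IsWalk G L (reverse L x)
  IsWalk-reverse {L} {x} walk b b<L =
    subst (λ v → Adj G (x v) (x (L ∸ suc b))) (≡.sym (ℕ.+-∸-assoc 1 b<L))
      (sym G (walk (L ∸ suc b) (ℕ.∸-monoʳ-< (s≤s z≤n) b<L)))

  IsWalk-append : ∀ m {l} {x y : ℕ → Fin n} → x m ≡ y 0 → IsWalk G m x → IsWalk G l y →
                  IsWalk G (m + l) (append m x y)
  IsWalk-append zero          join walkx walky = walky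
  IsWalk-append (suc m) {x = x} {y} join walkx walky zero    _ =
    subst (Adj G (x 0)) (≡.sym (append-head m join)) (walkx 0 (s≤s z≤n))
  IsWalk-append (suc m)       join walkx walky (suc a) a<m+l =
    IsWalk-append m join (λ b b<m → walkx (suc b) (s≤s b<m)) walky a (ℕ.≤-pred a<m+l)

  simple-closed-walk⇒cycle : ∀ {s} {x : ℕ → Fin n} → IsWalk G s x → NonBacktracking s x → 1 ≤ s →
                             x 0 ≡ x s → Injective _≡_ _≡_ (λ (i : Fin s) → x (toℕ i)) → 3 ≤ s × Cycle G s
  simple-closed-walk⇒cycle {1}     {x} walk nb _ closed _ =
    contradiction (subst (Adj G (x 0)) (≡.sym closed) (walk 0 (s≤s z≤n))) (irrefl G)
  simple-closed-walk⇒cycle {2}         walk nb _ closed _ = contradiction closed (nb 0 ℕ.≤-refl)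
  simple-closed-walk⇒cycle {suc (suc (suc _))} {x} walk nb _ closed injective =
    s≤s (s≤s (s≤s z≤n)) , (λ i → x (toℕ i)) , injective ,
    λ i → subst (Adj G (x (toℕ i))) (≡.sym (x-next i)) (walk (toℕ i) (toℕ<n i))
    where
      x-next : ∀ i → x (toℕ (next i)) ≡ x (suc (toℕ i))
      x-next i with toℕ-next i
      ... | inj₁ next≡       = cong x next≡
      ... | inj₂ (next≡0 , i+1≡s) = trans (cong x next≡0) (trans closed (cong x (≡.sym i+1≡s)))

  closed-walk⇒cycle : ∀ s {x : ℕ → Fin n} → IsWalk G s x → NonBacktracking s x → 1 ≤ s → x 0 ≡ x s →
                      ∃ λ r → 3 ≤ r × r ≤ s × Cycle G r
  closed-walk⇒cycle s = go (<-wellFounded s)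
    where
      go : ∀ {s} → Acc _<_ s → ∀ {x : ℕ → Fin n} → IsWalk G s x → NonBacktracking s x → 1 ≤ s → x 0 ≡ x s →
           ∃ λ r → 3 ≤ r × r ≤ s × Cycle G r
      go {s} (acc shorter) {x} walk nb 1≤s closed
        with Fin.any? (λ (i : Fin s) → Fin.any? (λ j → (i Fin.<? j) ×-dec (x (toℕ i) Fin.≟ x (toℕ j))))
      ... | no no-repeat = s , proj₁ simple , ℕ.≤-refl , proj₂ simple
        where
          injective : Injective _≡_ _≡_ (λ (i : Fin s) → x (toℕ i))
          injective {i} {j} xi≡xj with Fin.<-cmp i j
          ... | tri< i<j _ _ = contradiction (i , j , i<j , xi≡xj) no-repeat
          ... | tri≈ _ i≡j _ = i≡j
          ... | tri> _ _ j<i = contradiction (j , i , j<i , ≡.sym xi≡xj) no-repeat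
          simple = simple-closed-walk⇒cycle walk nb 1≤s closed injective
      ... | yes (i , j , i<j , xi≡xj) = shorten (go (shorter l<s) walk′ nb′ (ℕ.m<n⇒0<n∸m i<j) closed′)
        where
          l = toℕ j ∸ toℕ i
          i+l≡j : toℕ i + l ≡ toℕ j
          i+l≡j = ℕ.m+[n∸m]≡n (ℕ.<⇒≤ i<j)
          i+l≤s : toℕ i + l ≤ s
          i+l≤s = ℕ.≤-trans (ℕ.≤-reflexive i+l≡j) (ℕ.<⇒≤ (toℕ<n j))
          l<s : l < s
          l<s = ℕ.≤-<-trans (ℕ.m∸n≤m (toℕ j) (toℕ i)) (toℕ<n j)
          walk′ = IsWalk-segment walk i+l≤s
          nb′ = NonBacktracking-segment nb i+l≤s
          closed′ : segment (toℕ i) x 0 ≡ segment (toℕ i) x l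
          closed′ = trans (cong x (ℕ.+-identityʳ (toℕ i))) (trans xi≡xj (cong x (≡.sym i+l≡j)))
          shorten : (∃ λ r → 3 ≤ r × r ≤ l × Cycle G r) → ∃ λ r → 3 ≤ r × r ≤ s × Cycle G r
          shorten (r , 3≤r , r≤l , cycle) = r , 3≤r , ℕ.≤-trans r≤l (ℕ.<⇒≤ l<s) , cycle

  nonbacktracking-walks-agree : ∀ {L} {p q : ℕ → Fin n} → GirthAtLeast G (2 * L + 1) →
                                IsWalk G L p → IsWalk G L q → NonBacktracking L p → NonBacktracking L q →
                                p 0 ≡ q 0 → p L ≡ q L → ∀ t → t ≤ L → p t ≡ q t
  nonbacktracking-walks-agree {L} {p} {q} girth walkp walkq nbp nbq p0≡q0 pL≡qL t t≤L =
    agree (L ∸ t) t (ℕ.m+[n∸m]≡n t≤L)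
    where
      -- p 0, …, p (t + 1) followed by q t, …, q 0 is a closed walk of length 2 (t + 1) ≤ 2 L,
      -- and it can backtrack only at the junction, where p t ≡ q t.
      agree-before : ∀ t → suc t ≤ L → p (suc t) ≡ q (suc t) → p t ≡ q t
      agree-before t t<L join with p t Fin.≟ q t
      ... | yes pt≡qt = pt≡qt
      ... | no  pt≢qt = ⊥-elim (no-short-cycle (closed-walk⇒cycle (m + m) walk nb (s≤s z≤n) closed))
        where
          m = suc t
          x = append m p (reverse m q)
          walk : IsWalk G (m + m) x
          walk = IsWalk-append m {x = p} join (IsWalk-segment {a = 0} {x = p} walkp t<L)
                   (IsWalk-reverse {x = q} (IsWalk-segment {a = 0} {x = q} walkq t<L))
          nb : NonBacktracking (m + m) x
          nb = NonBacktracking-append t {x = p} join (NonBacktracking-segment {a = 0} {x = p} nbp t<L)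
                 (NonBacktracking-reverse {x = q} (NonBacktracking-segment {a = 0} {x = q} nbq t<L)) pt≢qt
          closed : x 0 ≡ x (m + m)
          closed = trans (append-head m {x = p} {reverse m q} join)
                     (trans p0≡q0 (≡.sym (trans (append-+ m {x = p} m) (cong q (ℕ.n∸n≡0 m)))))
          m+m≤2L : m + m ≤ 2 * L
          m+m≤2L = ℕ.+-mono-≤ t<L (ℕ.≤-trans t<L (ℕ.≤-reflexive (≡.sym (ℕ.+-identityʳ L))))
          no-short-cycle : ¬ (∃ λ r → 3 ≤ r × r ≤ m + m × Cycle G r)
          no-short-cycle (r , 3≤r , r≤ , cycle) =
            girth r 3≤r (ℕ.≤-<-trans (ℕ.≤-trans r≤ m+m≤2L) (ℕ.m<m+n (2 * L) (s≤s z≤n))) cycle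
      agree : ∀ d t → t + d ≡ L → p t ≡ q t
      agree zero    t t+0≡L = subst (λ v → p v ≡ q v) (trans (≡.sym t+0≡L) (ℕ.+-identityʳ t)) pL≡qL
      agree (suc d) t t+d+1≡L =
        agree-before t (ℕ.≤-trans (ℕ.m≤m+n (suc t) d) (ℕ.≤-reflexive (trans (≡.sym (ℕ.+-suc t d)) t+d+1≡L)))
          (agree d (suc t) (trans (≡.sym (ℕ.+-suc t d)) t+d+1≡L))

-- Products of permutations as walks

-- _∘ₚ_ composes in diagrammatic order, so prod γ applies γ fzero first, and
-- trajectory γ v t is the image of v under the first t factors.
trajectory : ∀ {n k} → (Fin k → Permutation′ n) → Fin n → ℕ → Fin n
trajectory {k = zero}  γ v t       = v
trajectory {k = suc k} γ v zero    = v
trajectory {k = suc k} γ v (suc t) = trajectory (γ ∘ fsuc) (γ fzero ⟨$⟩ʳ v) t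

module _ {n : ℕ} where

  trajectory-zero : ∀ {k} (γ : Fin k → Permutation′ n) v → trajectory γ v 0 ≡ v
  trajectory-zero {zero}  γ v = refl
  trajectory-zero {suc k} γ v = refl

  trajectory-suc : ∀ {k} (γ : Fin k → Permutation′ n) v i →
                   trajectory γ v (suc (toℕ i)) ≡ γ i ⟨$⟩ʳ trajectory γ v (toℕ i)
  trajectory-suc γ v fzero    = trajectory-zero (γ ∘ fsuc) (γ fzero ⟨$⟩ʳ v)
  trajectory-suc γ v (fsuc i) = trajectory-suc (γ ∘ fsuc) (γ fzero ⟨$⟩ʳ v) i

  trajectory-step : ∀ {k} (γ : Fin k → Permutation′ n) v {a} (a<k : a < k) →
                    trajectory γ v (suc a) ≡ γ (Fin.fromℕ< a<k) ⟨$⟩ʳ trajectory γ v a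
  trajectory-step γ v a<k =
    subst (λ b → trajectory γ v (suc b) ≡ γ (Fin.fromℕ< a<k) ⟨$⟩ʳ trajectory γ v b)
      (toℕ-fromℕ< a<k) (trajectory-suc γ v (Fin.fromℕ< a<k))

  trajectory-prod : ∀ {k} (γ : Fin k → Permutation′ n) v → trajectory γ v k ≡ prod γ ⟨$⟩ʳ v
  trajectory-prod {zero}  γ v = refl
  trajectory-prod {suc k} γ v = trajectory-prod (γ ∘ fsuc) (γ fzero ⟨$⟩ʳ v)

  trajectory-surjective : ∀ {k} (γ : Fin k → Permutation′ n) t u → ∃ λ v → trajectory γ v t ≡ u
  trajectory-surjective {zero}  γ t       u = u , refl
  trajectory-surjective {suc k} γ zero    u = u , refl
  trajectory-surjective {suc k} γ (suc t) u with v , v↦u ← trajectory-surjective (γ ∘ fsuc) t u =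
    γ fzero ⟨$⟩ˡ v , trans (cong (λ w → trajectory (γ ∘ fsuc) w t) (inverseʳ (γ fzero))) v↦u

lookup-injective : ∀ {a ℓ} {A : Set a} {_≈_ : Rel A ℓ} → Symmetric _≈_ →
                   ∀ {xs} → AllPairs (λ x y → ¬ x ≈ y) xs → ∀ i j → List.lookup xs i ≈ List.lookup xs j → i ≡ j
lookup-injective ≈-sym (_  ∷ _)   fzero    fzero    _   = refl
lookup-injective ≈-sym (x≉ ∷ _)   fzero    (fsuc j) x≈y = contradiction x≈y (All.lookup x≉ (∈-lookup j))
lookup-injective ≈-sym (x≉ ∷ _)   (fsuc i) fzero    y≈x = contradiction (≈-sym y≈x) (All.lookup x≉ (∈-lookup i))
lookup-injective ≈-sym (_  ∷ x≉s) (fsuc i) (fsuc j) x≈y = cong fsuc (lookup-injective ≈-sym x≉s i j x≈y)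

module _ {n : ℕ} (G : Graph n) (Q : Permutation′ n → Set)
         (Q⇒along : ∀ {π} → Q π → AlongEdges G π)
         (Q⇒nonReversing : ∀ {π ρ} → Q π → Q ρ → NonReversing π ρ) where

  module _ {k : ℕ} {γ : Fin k → Permutation′ n} (Qγ : ∀ i → Q (γ i)) (v : Fin n) where

    trajectory-isWalk : IsWalk G k (trajectory γ v)
    trajectory-isWalk a a<k =
      subst (Adj G (trajectory γ v a)) (≡.sym (trajectory-step γ v a<k)) (Q⇒along (Qγ _) _)

    trajectory-nonBacktracking : NonBacktracking k (trajectory γ v)
    trajectory-nonBacktracking a a+2≤k a↦a+2 =
      Q⇒nonReversing (Qγ (Fin.fromℕ< a<k)) (Qγ (Fin.fromℕ< a+2≤k)) (trajectory γ v a) (≡.sym (begin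
        trajectory γ v a                                                      ≡⟨ a↦a+2 ⟩
        trajectory γ v (suc (suc a))                                          ≡⟨ trajectory-step γ v a+2≤k ⟩
        γ (Fin.fromℕ< a+2≤k) ⟨$⟩ʳ trajectory γ v (suc a)
          ≡⟨ cong (γ (Fin.fromℕ< a+2≤k) ⟨$⟩ʳ_) (trajectory-step γ v a<k) ⟩
        γ (Fin.fromℕ< a+2≤k) ⟨$⟩ʳ (γ (Fin.fromℕ< a<k) ⟨$⟩ʳ trajectory γ v a)  ∎))
      where
        open ≡.≡-Reasoning
        a<k = ℕ.≤-trans (ℕ.n≤1+n (suc a)) a+2≤k

  module _ {k : ℕ} (girth : GirthAtLeast G (2 * k + 1)) where

    factors-unique : (γ δ : Fin k → Permutation′ n) → (∀ i → Q (γ i)) → (∀ i → Q (δ i)) →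
                     prod γ ≈ prod δ → ∀ i → γ i ≈ δ i
    factors-unique γ δ Qγ Qδ γ≈δ i u with v , v↦u ← trajectory-surjective γ (toℕ i) u = begin
      γ i ⟨$⟩ʳ u                            ≡⟨ cong (γ i ⟨$⟩ʳ_) (≡.sym v↦u) ⟩
      γ i ⟨$⟩ʳ trajectory γ v (toℕ i)       ≡⟨ ≡.sym (trajectory-suc γ v i) ⟩
      trajectory γ v (suc (toℕ i))          ≡⟨ agree (suc (toℕ i)) (toℕ<n i) ⟩
      trajectory δ v (suc (toℕ i))          ≡⟨ trajectory-suc δ v i ⟩
      δ i ⟨$⟩ʳ trajectory δ v (toℕ i)       ≡⟨ cong (δ i ⟨$⟩ʳ_) (≡.sym (agree (toℕ i) (ℕ.<⇒≤ (toℕ<n i)))) ⟩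
      δ i ⟨$⟩ʳ trajectory γ v (toℕ i)       ≡⟨ cong (δ i ⟨$⟩ʳ_) v↦u ⟩
      δ i ⟨$⟩ʳ u                            ∎
      where
        open ≡.≡-Reasoning
        agree : ∀ t → t ≤ k → trajectory γ v t ≡ trajectory δ v t
        agree = nonbacktracking-walks-agree G girth (trajectory-isWalk Qγ v) (trajectory-isWalk Qδ v)
                  (trajectory-nonBacktracking Qγ v) (trajectory-nonBacktracking Qδ v)
                  (trans (trajectory-zero γ v) (≡.sym (trajectory-zero δ v)))
                  (trans (trajectory-prod γ v) (trans (γ≈δ v) (≡.sym (trajectory-prod δ v))))

    isSkSet : ∀ {A} → AllPairs (λ π ρ → ¬ π ≈ ρ) A → All Q A → IsSkSet k A
    isSkSet {A} distinct QA = distinct , λ α β prod≈ i →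
      lookup-injective (λ π≈ρ u → ≡.sym (π≈ρ u)) distinct (α i) (β i)
        (factors-unique _ _ (Q-lookup ∘ α) (Q-lookup ∘ β) prod≈ i)
      where
        Q-lookup : ∀ i → Q (List.lookup A i)
        Q-lookup i = All.lookup QA (∈-lookup i)

-- Averaging over the Boolean cube

both-≤-half : ∀ a c {x y} → x ≤ a * c → y ≤ a * c → x + y ≤ 2 * a * c
both-≤-half a c x≤ y≤ = ℕ.≤-trans (ℕ.+-mono-≤ x≤ y≤)
  (ℕ.≤-reflexive (trans (cong (a * c +_) (≡.sym (ℕ.+-identityʳ (a * c)))) (≡.sym (ℕ.*-assoc 2 a c))))

sumCube : ∀ N → (Vec Bool N → ℕ) → ℕ
sumCube zero    f = f []
sumCube (suc N) f = sumCube N (f ∘ (true ∷_)) + sumCube N (f ∘ (false ∷_))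

sumCube-mono : ∀ N {f g : Vec Bool N → ℕ} → (∀ o → f o ≤ g o) → sumCube N f ≤ sumCube N g
sumCube-mono zero    f≤g = f≤g []
sumCube-mono (suc N) f≤g =
  ℕ.+-mono-≤ (sumCube-mono N (f≤g ∘ (true ∷_))) (sumCube-mono N (f≤g ∘ (false ∷_)))

sumCube-+ : ∀ N (f g : Vec Bool N → ℕ) → sumCube N (λ o → f o + g o) ≡ sumCube N f + sumCube N g
sumCube-+ zero    f g = refl
sumCube-+ (suc N) f g = trans (cong₂ _+_ (sumCube-+ N f₁ g₁) (sumCube-+ N f₀ g₀))
                              (+-interchange (sumCube N f₁) (sumCube N g₁) (sumCube N f₀) (sumCube N g₀))
  where
    f₁ g₁ f₀ g₀ : Vec Bool N → ℕ
    f₁ = f ∘ (true ∷_)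
    g₁ = g ∘ (true ∷_)
    f₀ = f ∘ (false ∷_)
    g₀ = g ∘ (false ∷_)

sumCube-half : ∀ N (f : Vec Bool (suc N) → ℕ) b → sumCube N (f ∘ (b ∷_)) ≤ sumCube (suc N) f
sumCube-half N f true  = ℕ.m≤m+n _ _
sumCube-half N f false = ℕ.m≤n+m _ _

sumCube-average : ∀ N (f : Vec Bool N → ℕ) → ∃ λ o → sumCube N f ≤ 2 ^ N * f o
sumCube-average zero    f = [] , ℕ.m≤m+n _ _
sumCube-average (suc N) f
  with o₁ , avg₁ ← sumCube-average N (f ∘ (true ∷_)) | o₀ , avg₀ ← sumCube-average N (f ∘ (false ∷_))
  with ℕ.≤-total (f (true ∷ o₁)) (f (false ∷ o₀))
... | inj₁ f₁≤f₀ = false ∷ o₀ , double (ℕ.≤-trans avg₁ (ℕ.*-monoʳ-≤ (2 ^ N) f₁≤f₀)) avg₀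
  where double = both-≤-half (2 ^ N) (f (false ∷ o₀))
... | inj₂ f₀≤f₁ = true ∷ o₁ , double avg₁ (ℕ.≤-trans avg₀ (ℕ.*-monoʳ-≤ (2 ^ N) f₀≤f₁))
  where double = both-≤-half (2 ^ N) (f (true ∷ o₁))

indicator : ∀ {p} {P : Set p} → Dec P → ℕ
indicator (yes _) = 1
indicator (no  _) = 0

indicator-mono : ∀ {p q} {P : Set p} {Q : Set q} (P? : Dec P) (Q? : Dec Q) →
                 (P → Q) → indicator P? ≤ indicator Q?
indicator-mono (yes p) (yes _) P⇒Q = ℕ.≤-refl
indicator-mono (yes p) (no ¬q) P⇒Q = contradiction (P⇒Q p) ¬q
indicator-mono (no _)  _       P⇒Q = z≤n

length-filter-∷ : ∀ {a p} {A : Set a} {P : A → Set p} (P? : Decidable P) x xs →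
                  length (List.filter P? (x ∷ xs)) ≡ indicator (P? x) + length (List.filter P? xs)
length-filter-∷ P? x xs with P? x
... | yes _ = refl
... | no  _ = refl

Constraint : ℕ → Set
Constraint N = Fin N × Bool

module _ {N : ℕ} where

  Holds : Vec Bool N → Constraint N → Set
  Holds o (j , b) = lookup o j ≡ b

  Sat : Vec Bool N → List (Constraint N) → Set
  Sat o = All (Holds o)

  sat? : ∀ o L → Dec (Sat o L)
  sat? o = All.all? (λ (j , b) → lookup o j Bool.≟ b)

  Consistent : List (Constraint N) → Set
  Consistent L = ∀ {c d} → c ∈ L → d ∈ L → proj₁ c ≡ proj₁ d → proj₂ c ≡ proj₂ d

  #satisfying : List (Constraint N) → ℕ
  #satisfying L = sumCube N (λ o → indicator (sat? o L))

module _ {N : ℕ} where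

  shift : List (Constraint (suc N)) → List (Constraint N)
  shift []                  = []
  shift ((fzero  , _) ∷ L) = shift L
  shift ((fsuc j , b) ∷ L) = (j , b) ∷ shift L

  shift-∈ : ∀ L {c} → c ∈ shift L → (fsuc (proj₁ c) , proj₂ c) ∈ L
  shift-∈ ((fzero  , _) ∷ L) c∈    = there (shift-∈ L c∈)
  shift-∈ ((fsuc j , b) ∷ L) (here refl) = here refl
  shift-∈ ((fsuc j , b) ∷ L) (there c∈)  = there (shift-∈ L c∈)

  shift-consistent : ∀ {L} → Consistent L → Consistent (shift L)
  shift-consistent {L} consistent c∈ d∈ j≡j′ = consistent (shift-∈ L c∈) (shift-∈ L d∈) (cong fsuc j≡j′)

  length-shift : ∀ L → length (shift L) ≤ length L
  length-shift []                  = z≤n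
  length-shift ((fzero  , _) ∷ L) = ℕ.m≤n⇒m≤1+n (length-shift L)
  length-shift ((fsuc j , b) ∷ L) = s≤s (length-shift L)

  length-shift-< : ∀ L {b} → (fzero , b) ∈ L → length (shift L) < length L
  length-shift-< ((fzero  , _) ∷ L) _           = s≤s (length-shift L)
  length-shift-< ((fsuc j , _) ∷ L) (there 0∈) = s≤s (length-shift-< L 0∈)

  Sat-shift : ∀ L {b o} → (∀ {c} → c ∈ L → proj₁ c ≡ fzero → proj₂ c ≡ b) → Sat o (shift L) → Sat (b ∷ o) L
  Sat-shift []                 fixed sat           = []
  Sat-shift ((fzero  , _) ∷ L) fixed sat           = ≡.sym (fixed (here refl) refl) ∷ Sat-shift L (fixed ∘ there) sat
  Sat-shift ((fsuc j , _) ∷ L) fixed (holds ∷ sat) = holds ∷ Sat-shift L (fixed ∘ there) sat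

  #satisfying-shift : ∀ L {b} → (∀ {c} → c ∈ L → proj₁ c ≡ fzero → proj₂ c ≡ b) →
                     #satisfying (shift L) ≤ sumCube N (λ o → indicator (sat? (b ∷ o) L))
  #satisfying-shift L fixed =
    sumCube-mono N (λ o → indicator-mono (sat? o (shift L)) (sat? (_ ∷ o) L) (Sat-shift L fixed))

#satisfying-bound : ∀ N (L : List (Constraint N)) → Consistent L → 2 ^ N ≤ 2 ^ length L * #satisfying L
#satisfying-bound zero    []             _ = ℕ.≤-refl
#satisfying-bound zero    ((() , _) ∷ _) _
#satisfying-bound (suc N) L consistent with Any.any? (λ c → proj₁ c Fin.≟ fzero) L
... | yes bit0-fixed with (_ , b) , 0b∈L , refl ← find bit0-fixed = begin
  2 * 2 ^ N                                            ≤⟨ ℕ.*-monoʳ-≤ 2 shifted ⟩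
  2 * (2 ^ length (shift L) * #satisfying (shift L))   ≡⟨ ≡.sym (ℕ.*-assoc 2 (2 ^ length (shift L)) _) ⟩
  2 ^ suc (length (shift L)) * #satisfying (shift L)   ≤⟨ ℕ.*-mono-≤ (ℕ.^-monoʳ-≤ 2 (length-shift-< L 0b∈L)) half ⟩
  2 ^ length L * #satisfying L                         ∎
  where
    open ℕ.≤-Reasoning
    shifted : 2 ^ N ≤ 2 ^ length (shift L) * #satisfying (shift L)
    shifted = #satisfying-bound N (shift L) (shift-consistent consistent)
    half : #satisfying (shift L) ≤ #satisfying L
    half = ℕ.≤-trans (#satisfying-shift L (λ c∈L c₀≡0 → consistent c∈L 0b∈L c₀≡0))
                     (sumCube-half N (λ o → indicator (sat? o L)) b)
... | no bit0-free = begin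
  2 ^ N + (2 ^ N + 0)                            ≡⟨ cong (2 ^ N +_) (ℕ.+-identityʳ (2 ^ N)) ⟩
  2 ^ N + 2 ^ N                                  ≤⟨ ℕ.+-mono-≤ (half true) (half false) ⟩
  2 ^ length L * S true + 2 ^ length L * S false ≡⟨ ≡.sym (ℕ.*-distribˡ-+ (2 ^ length L) (S true) (S false)) ⟩
  2 ^ length L * #satisfying L                   ∎
  where
    open ℕ.≤-Reasoning
    S : Bool → ℕ
    S b = sumCube N (λ o → indicator (sat? (b ∷ o) L))
    half : ∀ b → 2 ^ N ≤ 2 ^ length L * S b
    half b = ℕ.≤-trans (#satisfying-bound N (shift L) (shift-consistent consistent))
      (ℕ.*-mono-≤ (ℕ.^-monoʳ-≤ 2 (length-shift L))
        (#satisfying-shift L (λ c∈L c₀≡0 → contradiction c₀≡0 (All.lookup (All.¬Any⇒All¬ L bit0-free) c∈L))))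

satisfied : ∀ {X : Set} {N} → (X → List (Constraint N)) → Vec Bool N → List X → List X
satisfied C o = List.filter (λ x → sat? o (C x))

module _ {X : Set} {N m : ℕ} (C : X → List (Constraint N))
         (C-consistent : ∀ x → Consistent (C x)) (C-length : ∀ x → length (C x) ≤ m) where

  expected-satisfied : ∀ xs → 2 ^ N * length xs ≤ 2 ^ m * sumCube N (λ o → length (satisfied C o xs))
  expected-satisfied []       = ℕ.≤-trans (ℕ.≤-reflexive (ℕ.*-zeroʳ (2 ^ N))) z≤n
  expected-satisfied (x ∷ xs) = begin
    2 ^ N * suc (length xs)                      ≡⟨ ℕ.*-suc (2 ^ N) (length xs) ⟩
    2 ^ N + 2 ^ N * length xs                    ≤⟨ ℕ.+-mono-≤ x-bound (expected-satisfied xs) ⟩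
    2 ^ m * #satisfying (C x) + 2 ^ m * count xs ≡⟨ ≡.sym (ℕ.*-distribˡ-+ (2 ^ m) _ _) ⟩
    2 ^ m * (#satisfying (C x) + count xs)       ≡⟨ cong (2 ^ m *_) (≡.sym (sumCube-+ N _ _)) ⟩
    2 ^ m * sumCube N (λ o → indicator (sat? o (C x)) + length (satisfied C o xs))
      ≤⟨ ℕ.*-monoʳ-≤ (2 ^ m) (sumCube-mono N (λ o → ℕ.≤-reflexive (≡.sym (length-filter-∷ _ x xs)))) ⟩
    2 ^ m * count (x ∷ xs)                       ∎
    where
      open ℕ.≤-Reasoning
      count : List X → ℕ
      count ys = sumCube N (λ o → length (satisfied C o ys))
      x-bound : 2 ^ N ≤ 2 ^ m * #satisfying (C x)
      x-bound = ℕ.≤-trans (#satisfying-bound N (C x) (C-consistent x))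
                  (ℕ.*-monoˡ-≤ (#satisfying (C x)) (ℕ.^-monoʳ-≤ 2 (C-length x)))

  ∃-assignment-satisfying : ∀ xs → ∃ λ o → length xs ≤ 2 ^ m * length (satisfied C o xs)
  ∃-assignment-satisfying xs with o , average ← sumCube-average N (λ o → length (satisfied C o xs)) =
    o , ℕ.*-cancelˡ-≤ (2 ^ N) {{ℕ.m^n≢0 2 N}} (begin
      2 ^ N * length xs                                   ≤⟨ expected-satisfied xs ⟩
      2 ^ m * sumCube N (λ o → length (satisfied C o xs)) ≤⟨ ℕ.*-monoʳ-≤ (2 ^ m) average ⟩
      2 ^ m * (2 ^ N * length (satisfied C o xs))         ≡⟨ *-comm-middle (2 ^ m) (2 ^ N) _ ⟩
      2 ^ N * (2 ^ m * length (satisfied C o xs))         ∎)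
    where open ℕ.≤-Reasoning

-- Orientations of the complete graph

module _ {n : ℕ} where

  -- An orientation has one bit per edge {u, w}, at index combine (min u w) (max u w);
  -- arc u w is the constraint that this edge points from u to w.
  arc : Fin n → Fin n → Constraint (n * n)
  arc u w with u Fin.<? w
  ... | yes _ = Fin.combine u w , true
  ... | no  _ = Fin.combine w u , false

  arc-antisym : ∀ o {u w} → Holds o (arc u w) → Holds o (arc w u) → u ≡ w
  arc-antisym o {u} {w} holds-uw holds-wu with u Fin.<? w | w Fin.<? u
  ... | yes u<w | yes w<u = contradiction w<u (Fin.<-asym u<w)
  ... | yes _   | no  _   = contradiction (trans (≡.sym holds-uw) holds-wu) λ ()
  ... | no  _   | yes _   = contradiction (trans (≡.sym holds-wu) holds-uw) λ ()
  ... | no  u≮w | no  w≮u = toℕ-injective (ℕ.≤-antisym (ℕ.≮⇒≥ w≮u) (ℕ.≮⇒≥ u≮w))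

  arc-index : ∀ {u w u′ w′} → proj₁ (arc u w) ≡ proj₁ (arc u′ w′) → arc u w ≡ arc u′ w′ ⊎ (u ≡ w′ × w ≡ u′)
  arc-index {u} {w} {u′} {w′} same-index with u Fin.<? w | u′ Fin.<? w′
  ... | yes _ | yes _ = inj₁ (cong (_, true) same-index)
  ... | no  _ | no  _ = inj₁ (cong (_, false) same-index)
  ... | yes _ | no  _ = inj₂ (Fin.combine-injective u w w′ u′ same-index)
  ... | no  _ | yes _ = inj₂ (swap (Fin.combine-injective w u u′ w′ same-index))

  arcs : Permutation′ n → List (Constraint (n * n))
  arcs π = List.map (λ u → arc u (π ⟨$⟩ʳ u)) (List.allFin n)

  length-arcs : ∀ π → length (arcs π) ≡ n
  length-arcs π = trans (List.length-map _ (List.allFin n)) (List.length-tabulate _)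

  arcs-consistent : ∀ π → NonReversing π π → Consistent (arcs π)
  arcs-consistent π nonReversing c∈ d∈ same-index
    with u , _ , refl ← ∈-map⁻ (λ u → arc u (π ⟨$⟩ʳ u)) c∈
       | u′ , _ , refl ← ∈-map⁻ (λ u → arc u (π ⟨$⟩ʳ u)) d∈
    with arc-index same-index
  ... | inj₁ same-arc = cong proj₂ same-arc
  ... | inj₂ (u≡πu′ , πu≡u′) = contradiction (trans (cong (π ⟨$⟩ʳ_) (≡.sym u≡πu′)) πu≡u′) (nonReversing u′)

  Follows : Vec Bool (n * n) → Permutation′ n → Set
  Follows o π = Sat o (arcs π)

  follows-arc : ∀ {o π} → Follows o π → ∀ u → Holds o (arc u (π ⟨$⟩ʳ u))
  follows-arc {π = π} follows u = All.lookup follows (∈-map⁺ (λ u → arc u (π ⟨$⟩ʳ u)) (∈-allFin u))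

  Oriented : Graph n → Vec Bool (n * n) → Permutation′ n → Set
  Oriented G o π = AlongEdges G π × Follows o π

  oriented-nonReversing : ∀ (G : Graph n) {o π ρ} → Oriented G o π → Oriented G o ρ → NonReversing π ρ
  oriented-nonReversing G {o} {π} {ρ} (along , follows-π) (_ , follows-ρ) u ρπu≡u =
    irrefl G (subst (Adj G u) (≡.sym (arc-antisym o (follows-arc {o} {π} follows-π u) back)) (along u))
    where back = subst (λ v → Holds o (arc (π ⟨$⟩ʳ u) v)) ρπu≡u (follows-arc {o} {ρ} follows-ρ (π ⟨$⟩ʳ u))

module _ {n h : ℕ} (G : Graph n) (H : Vec (HamCycle G) h)
         (H-distinct : ∀ (i j : Fin h) → i ≢ j → ¬ SameCycle G (lookup H i) (lookup H j)) where

  private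
    σ : Fin h → Permutation′ n
    σ i = rotation G (lookup H i)
    cycle : Fin h ⊎ Fin h → Fin n → Fin n
    cycle x = proj₁ (proj₂ (lookup H (reduce x)))

  traversal : Fin h ⊎ Fin h → Permutation′ n
  traversal = [ σ , flip ∘ σ ]′

  traversal-along : ∀ x → AlongEdges G (traversal x)
  traversal-along (inj₁ i) = rotation-adjacent G (lookup H i)
  traversal-along (inj₂ i) = AlongEdges-flip G {σ i} (rotation-adjacent G (lookup H i))

  traversal-nonReversing : ∀ x → NonReversing (traversal x) (traversal x)
  traversal-nonReversing (inj₁ i) = rotation²≢id G (lookup H i)
  traversal-nonReversing (inj₂ i) = NonReversing-flip {π = σ i} (rotation²≢id G (lookup H i))

  traversal-edges : ∀ x {u w} → CycEdge (cycle x) u w ⇔ PermEdge (traversal x) u w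
  traversal-edges (inj₁ i) = CycEdge⇔PermEdge G (lookup H i)
  traversal-edges (inj₂ i) =
    mk⇔ (PermEdge-flip (σ i)) (PermEdge-flip (flip (σ i))) ⇔-∘ CycEdge⇔PermEdge G (lookup H i)

  traversal-≈⇒same-edges : ∀ x y → traversal x ≈ traversal y →
                           ∀ {u w} → CycEdge (cycle x) u w → CycEdge (cycle y) u w
  traversal-≈⇒same-edges x y x≈y =
    Equivalence.from (traversal-edges y) ∘ PermEdge-≈ {π = traversal x} {traversal y} x≈y ∘
    Equivalence.to (traversal-edges x)

  traversal-≈⇒same-index : ∀ x y → traversal x ≈ traversal y → reduce x ≡ reduce y
  traversal-≈⇒same-index x y x≈y with reduce x Fin.≟ reduce y
  ... | yes i≡j = i≡j
  ... | no  i≢j = contradiction (λ u w → traversal-≈⇒same-edges x y x≈y , traversal-≈⇒same-edges y x (≡.sym ∘ x≈y))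
                    (H-distinct _ _ i≢j)

  traversal-injective : ∀ x y → traversal x ≈ traversal y → x ≡ y
  traversal-injective x y x≈y with traversal-≈⇒same-index x y x≈y
  traversal-injective (inj₁ i) (inj₁ j) _     | i≡j  = cong inj₁ i≡j
  traversal-injective (inj₂ i) (inj₂ j) _     | i≡j  = cong inj₂ i≡j
  traversal-injective (inj₁ i) (inj₂ j) σ≈σ⁻¹ | refl = contradiction σ≈σ⁻¹ (rotation≉flip G (lookup H i))
  traversal-injective (inj₂ i) (inj₁ j) σ⁻¹≈σ | refl =
    contradiction (≡.sym ∘ σ⁻¹≈σ) (rotation≉flip G (lookup H i))

  candidate : Fin (h + h) → Permutation′ n
  candidate = traversal ∘ Fin.splitAt h

  candidate-injective : ∀ i j → candidate i ≈ candidate j → i ≡ j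
  candidate-injective i j i≈j = begin
    i                              ≡⟨ ≡.sym (Fin.join-splitAt h h i) ⟩
    Fin.join h h (Fin.splitAt h i) ≡⟨ cong (Fin.join h h) same-traversal ⟩
    Fin.join h h (Fin.splitAt h j) ≡⟨ Fin.join-splitAt h h j ⟩
    j                              ∎
    where
      open ≡.≡-Reasoning
      same-traversal : Fin.splitAt h i ≡ Fin.splitAt h j
      same-traversal = traversal-injective (Fin.splitAt h i) (Fin.splitAt h j) i≈j

  large-oriented-subfamily : ∃ λ o → ∃ λ A →
    AllPairs (λ π ρ → ¬ π ≈ ρ) A × All (Oriented G o) A × h + h ≤ 2 ^ n * length A
  large-oriented-subfamily = o , List.map candidate chosen , distinct , oriented , large
    where
      indices : List (Fin (h + h))
      indices = List.allFin (h + h)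
      assignment : ∃ λ o → length indices ≤ 2 ^ n * length (satisfied (arcs ∘ candidate) o indices)
      assignment = ∃-assignment-satisfying (arcs ∘ candidate)
        (λ i → arcs-consistent (candidate i) (traversal-nonReversing (Fin.splitAt h i)))
        (λ i → ℕ.≤-reflexive (length-arcs (candidate i))) indices
      o : Vec Bool (n * n)
      o = proj₁ assignment
      follows? : ∀ i → Dec (Follows o (candidate i))
      follows? i = sat? o (arcs (candidate i))
      chosen : List (Fin (h + h))
      chosen = satisfied (arcs ∘ candidate) o indices
      distinct : AllPairs (λ π ρ → ¬ π ≈ ρ) (List.map candidate chosen)
      distinct = AllPairs.map⁺ (AllPairs.filter⁺ follows?
        (AllPairs.tabulate⁺ {f = id} (λ {i} {j} i≢j → i≢j ∘ candidate-injective i j)))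
      oriented : All (Oriented G o) (List.map candidate chosen)
      oriented = All.map⁺ (All.zip
        (All.filter⁺ follows? (All.tabulate⁺ {f = id} (traversal-along ∘ Fin.splitAt h)) ,
         All.all-filter follows? indices))
      large : h + h ≤ 2 ^ n * length (List.map candidate chosen)
      large = subst₂ (λ a b → a ≤ 2 ^ n * b) (List.length-tabulate id) (≡.sym (List.length-map candidate chosen))
                (proj₂ assignment)

half-bound : ∀ n {h a} → h + h ≤ 2 ^ n * a → h ≤ 2 ^ (n ∸ 1) * a
half-bound zero    {h} h+h≤a = ℕ.≤-trans (ℕ.m≤m+n h h) h+h≤a
half-bound (suc n) {h} {a} h+h≤2ⁿ⁺¹a = ℕ.*-cancelˡ-≤ 2 (begin
  2 * h                ≡⟨ cong (h +_) (ℕ.+-identityʳ h) ⟩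
  h + h                ≤⟨ h+h≤2ⁿ⁺¹a ⟩
  2 * 2 ^ n * a        ≡⟨ ℕ.*-assoc 2 (2 ^ n) a ⟩
  2 * (2 ^ n * a)      ∎)
  where open ℕ.≤-Reasoning

theorem1p11 : (k n h : ℕ) → 1 ≤ k → (G : Graph n) → GirthAtLeast G (2 * k + 1) →
    (H : Vec (HamCycle G) h) → (∀ (i j : Fin h) → i ≢ j → ¬ SameCycle G (lookup H i) (lookup H j)) →
    Σ (List (Permutation′ n)) (λ A → IsSkSet k A × h ≤ 2 ^ (n ∸ 1) * length A)
-- The argument works for every k.
theorem1p11 k n h _ G girth H H-distinct =
  let o , A , distinct , oriented , large = large-oriented-subfamily G H H-distinct in
  A , isSkSet G (Oriented G o) proj₁ (λ {π} {ρ} → oriented-nonReversing G {o} {π} {ρ}) girth distinct oriented ,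
  half-bound n large
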